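{- Every packed word $w$ can be written uniquely as $w=v_1*v_2*\dots*v_n$ (with $n\ge 0$), where each $v_i$ is a non-trivial (i.e. non-empty) irreducible packed word.
   Context: $X=\{x_i\}_{i\ge 0}$ is an alphabet totally ordered by index, $X^*$ the free monoid of words over it, with empty word $1_{X^*}$. For a word $w$, $IAlph(w)=\{i\in\mathbb N: x_i\text{ occurs in }w\}$ and $sup(w)$ is the supremum of $IAlph(w)$ in $\mathbb N$ ($sup(1_{X^*})=0$). For $\phi$ defined on $IAlph(w)$ with values in $\mathbb N$ and $\phi(0)=0$, $S_\phi(x_{i_1}\cdots x_{i_m})=x_{\phi(i_1)}\cdots x_{\phi(i_m)}$. If $IAlph(w)\setminus\{0\}=\{j_1<\dots<j_k\}$, let $\phi_w(j_m)=m$, $\phi_w(0)=0$, and $pack(w)=S_{\phi_w}(w)$; $w$ is packed if $pack(w)=w$. For $t\in\mathbb N$, $T_t(w)=S_\phi(w)$ with $\phi(n)=n+t$ for $n>0$, $\phi(0)=0$. The shifted concatenation is $u*v=u\,T_{sup(u)}(v)$; it is associative and maps pairs of packed words to packed words. A packed word $w$ is irreducible if it cannot be written as $w=u*v$ with $u,v$ non-trivial (non-empty) packed words. -}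

module Defs where

open import Data.Nat using (ℕ; zero; suc; _+_; _⊔_; _≤ᵇ_)
open import Data.Nat.Properties using (_≟_)
open import Data.List using (List; []; _∷_; _++_; map; foldr; length; filter; deduplicate)
open import Data.Bool using (Bool; true; false; _∧_; not)
open import Data.Product using (Σ; _×_; _,_)
open import Relation.Binary.PropositionalEquality using (_≡_)
open import Relation.Nullary using (¬_)
open import Relation.Nullary.Decidable using (⌊_⌋)

-- A word over X = {x_i} is a list of indices: the letter x_i is represented by i.
Word : Set
Word = List ℕ

sup : Word → ℕ
sup = foldr _⊔_ 0

S : (ℕ → ℕ) → Word → Word
S φ = map φ

nonzeroAlph : Word → List ℕ
nonzeroAlph w = deduplicate _≟_ (filter (λ i → Relation.Nullary.Decidable.¬? (i ≟ 0)) w)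

-- φ_w(j) = m when j is the m-th smallest element of IAlph(w)\{0};
-- i.e. φ_w(j) = #{k ∈ IAlph(w)\{0} | k ≤ j} for j ∈ IAlph(w), and φ_w(0) = 0.
phi : Word → ℕ → ℕ
phi w zero = zero
phi w (suc j) = length (filter (λ k → Data.Nat._≤?_ k (suc j)) (nonzeroAlph w))

pack : Word → Word
pack w = S (phi w) w

Packed : Word → Set
Packed w = pack w ≡ w

shiftφ : ℕ → ℕ → ℕ
shiftφ t zero = zero
shiftφ t (suc n) = suc n + t

T : ℕ → Word → Word
T t = S (shiftφ t)

_⋆_ : Word → Word → Word
u ⋆ v = u ++ T (sup u) v

infixr 6 _⋆_

NonEmpty : Word → Set
NonEmpty w = ¬ (w ≡ [])

Irreducible : Word → Set
Irreducible w = Packed w ×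
  ((u v : Word) → Packed u → Packed v → NonEmpty u → NonEmpty v → ¬ (w ≡ u ⋆ v))

⋆-product : List Word → Word
⋆-product = foldr _⋆_ []

data AllIrr : List Word → Set where
  []  : AllIrr []
  _∷_ : ∀ {v vs} → (NonEmpty v × Irreducible v) → AllIrr vs → AllIrr (v ∷ vs)

IrrFactorisation : Word → List Word → Set
IrrFactorisation w vs = AllIrr vs × ⋆-product vs ≡ w

module Submission where

-- Existence is by well-founded induction on the length: reducibility is
-- decidable, since a splitting w = u ⋆ v is determined by the cut point |u|;
-- an irreducible word is its own factorisation, and a reducible one is the
-- concatenation of factorisations of its two shorter factors (⋆ is
-- associative).
--
-- Uniqueness rests on one fact: if u and u ⋆ v are packed, so is v.  To see
-- it, pack is expressed by counting: φ_w(a) is the number of distinct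
-- non-zero letters of w that are ≤ a, so w is packed iff each letter a of w
-- has exactly a such letters.  In u ⋆ v the letters of u are ≤ sup u while
-- the non-zero letters of T_{sup u}(v) are > sup u, so these counts split
-- additively.  Hence an irreducible word has no proper non-empty packed left
-- factor, which forces the leading factors of two factorisations of the same
-- word to agree; cancelling them, the rest follows by induction.

open import Defs
open import Data.Nat using (ℕ; zero; suc; _+_; _∸_; _⊔_; _≤_; _<_; s≤s; z<s; _≤?_)
open import Data.Nat.Properties
open import Data.Nat.Induction using (<-wellFounded)
open import Data.List using (List; []; _∷_; [_]; _++_; map; length; filter; take; drop)
open import Data.List.Properties
  using (map-++; map-∘; map-cong; map-id; map-id-local; length-++; length-map; length-++-≤ˡ;
         ++-assoc; ++-identityʳ; ++-cancelˡ; ++-conicalˡ; ∷-injectiveˡ; ∷-injectiveʳ;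
         take-map; filter-accept; filter-reject; ≡-dec)
open import Data.List.Membership.Propositional using (_∈_; _∉_)
open import Data.List.Membership.Propositional.Properties
  using (∈-++⁺ˡ; ∈-++⁺ʳ; ∈-++⁻; ∈-map⁺; ∈-map⁻; ∈-filter⁺; ∈-filter⁻; ∈-deduplicate⁺; ∈-deduplicate⁻)
open import Data.List.Membership.DecPropositional _≟_ using (_∈?_)
open import Data.List.Relation.Unary.Any using (here; there)
open import Data.List.Relation.Unary.All as All using (All; []; _∷_)
open import Data.List.Relation.Unary.All.Properties using (All¬⇒¬Any; all-filter; deduplicate⁺)
open import Data.List.Relation.Unary.Unique.Propositional using (Unique)
open import Data.List.Relation.Unary.AllPairs using ([]; _∷_)
open import Data.List.Relation.Unary.Unique.DecPropositional.Properties _≟_ using (deduplicate-!)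
open import Algebra.Properties.CommutativeSemigroup +-commutativeSemigroup using (interchange)
open import Data.Product using (Σ; _×_; _,_; proj₁; proj₂)
open import Data.Sum using (_⊎_; inj₁; inj₂)
open import Data.Empty using (⊥-elim)
open import Function using (_∘_)
open import Induction.WellFounded using (Acc; acc)
open import Relation.Binary.PropositionalEquality using (_≡_; _≢_; refl; sym; trans; cong; cong₂; subst; module ≡-Reasoning)
open import Relation.Nullary using (¬_; Dec; yes; no; contradiction)
open import Relation.Nullary.Decidable using (¬?; _×-dec_)

open ≡-Reasoning


occurs : Word → ℕ → ℕ
occurs w k with k ∈? w
... | yes _ = 1
... | no  _ = 0

occurs-∈ : ∀ {w k} → k ∈ w → occurs w k ≡ 1
occurs-∈ {w} {k} k∈w with k ∈? w
... | yes _   = refl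
... | no  k∉w = contradiction k∈w k∉w

occurs-∉ : ∀ {w k} → k ∉ w → occurs w k ≡ 0
occurs-∉ {w} {k} k∉w with k ∈? w
... | yes k∈w = contradiction k∈w k∉w
... | no  _   = refl

occurs-cong : ∀ {v w k l} → (k ∈ v → l ∈ w) → (l ∈ w → k ∈ v) → occurs v k ≡ occurs w l
occurs-cong {v} {w} {k} {l} to from with k ∈? v
... | yes k∈v = sym (occurs-∈ (to k∈v))
... | no  k∉v = sym (occurs-∉ (k∉v ∘ from))

occurs-∷ : ∀ {x xs} → x ∉ xs → ∀ k → occurs (x ∷ xs) k ≡ occurs [ x ] k + occurs xs k
occurs-∷ {x} {xs} x∉xs k = by-cases (k ≟ x)
  where
  drop-x : k ≢ x → k ∈ x ∷ xs → k ∈ xs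
  drop-x k≢x (here k≡x)   = contradiction k≡x k≢x
  drop-x _   (there k∈xs) = k∈xs
  by-cases : Dec (k ≡ x) → occurs (x ∷ xs) k ≡ occurs [ x ] k + occurs xs k
  by-cases (yes refl) = trans (occurs-∈ (here refl)) (sym (cong₂ _+_ (occurs-∈ (here refl)) (occurs-∉ x∉xs)))
  by-cases (no  k≢x)  = trans (occurs-cong (drop-x k≢x) there)
                              (cong (_+ occurs xs k) (sym (occurs-∉ λ { (here k≡x) → k≢x k≡x })))

Σ₁ : (ℕ → ℕ) → ℕ → ℕ
Σ₁ f zero    = 0
Σ₁ f (suc n) = Σ₁ f n + f (suc n)

Σ₁-cong : ∀ {f g} n → (∀ m → m < n → f (suc m) ≡ g (suc m)) → Σ₁ f n ≡ Σ₁ g n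
Σ₁-cong zero    _  = refl
Σ₁-cong (suc n) eq = cong₂ _+_ (Σ₁-cong n (λ m m<n → eq m (m<n⇒m<1+n m<n))) (eq n ≤-refl)

Σ₁-zero : ∀ {f} n → (∀ m → m < n → f (suc m) ≡ 0) → Σ₁ f n ≡ 0
Σ₁-zero zero    _  = refl
Σ₁-zero (suc n) eq = cong₂ _+_ (Σ₁-zero n (λ m m<n → eq m (m<n⇒m<1+n m<n))) (eq n ≤-refl)

Σ₁-+ : ∀ f g n → Σ₁ (λ k → f k + g k) n ≡ Σ₁ f n + Σ₁ g n
Σ₁-+ f g zero    = refl
Σ₁-+ f g (suc n) = trans (cong (_+ (f (suc n) + g (suc n))) (Σ₁-+ f g n))
                   (interchange (Σ₁ f n) (Σ₁ g n) (f (suc n)) (g (suc n)))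

Σ₁-split : ∀ f s n → Σ₁ f (n + s) ≡ Σ₁ f s + Σ₁ (λ k → f (k + s)) n
Σ₁-split f s zero    = sym (+-identityʳ _)
Σ₁-split f s (suc n) = trans (cong (_+ f (suc n + s)) (Σ₁-split f s n))
                       (+-assoc (Σ₁ f s) (Σ₁ (λ k → f (k + s)) n) (f (suc n + s)))

count : Word → ℕ → ℕ
count w = Σ₁ (occurs w)

count-∷ : ∀ {x xs} → x ∉ xs → ∀ n → count (x ∷ xs) n ≡ count [ x ] n + count xs n
count-∷ x∉xs n = trans (Σ₁-cong n (λ m _ → occurs-∷ x∉xs (suc m))) (Σ₁-+ _ _ n)

count-below : ∀ {x n} → n < x → count [ x ] n ≡ 0
count-below {x} {n} n<x = Σ₁-zero n λ m m<n →
  occurs-∉ λ { (here 1+m≡x) → <-irrefl 1+m≡x (≤-<-trans m<n n<x) }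

count-above : ∀ {x n} → x ≢ 0 → x ≤ n → count [ x ] n ≡ 1
count-above {n = zero} x≢0 x≤0 = contradiction (n≤0⇒n≡0 x≤0) x≢0
count-above {x} {suc n} x≢0 x≤1+n with x ≟ suc n
... | yes refl = cong₂ _+_ (count-below (n<1+n n)) (occurs-∈ (here refl))
... | no  x≢1+n = cong₂ _+_ (count-above x≢0 (m<1+n⇒m≤n (≤∧≢⇒< x≤1+n x≢1+n)))
                            (occurs-∉ λ { (here 1+n≡x) → x≢1+n (sym 1+n≡x) })

length-filter≡count : ∀ {xs} → Unique xs → All (_≢ 0) xs → ∀ n →
                      length (filter (_≤? n) xs) ≡ count xs n
length-filter≡count {[]} _ _ n = sym (Σ₁-zero n (λ m _ → occurs-∉ {[]} {suc m} λ ()))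
length-filter≡count {x ∷ xs} (x∉xs ∷ unique) (x≢0 ∷ nonzero) n =
  trans (head (x ≤? n)) (sym (count-∷ (All¬⇒¬Any x∉xs) n))
  where
  rest : length (filter (_≤? n) xs) ≡ count xs n
  rest = length-filter≡count unique nonzero n
  head : Dec (x ≤ n) → length (filter (_≤? n) (x ∷ xs)) ≡ count [ x ] n + count xs n
  head (yes x≤n) = trans (cong length (filter-accept (_≤? n) x≤n))
                         (cong₂ _+_ (sym (count-above x≢0 x≤n)) rest)
  head (no  x≰n) = trans (cong length (filter-reject (_≤? n) x≰n))
                         (cong₂ _+_ (sym (count-below (≰⇒> x≰n))) rest)

phi≡count : ∀ w a → phi w a ≡ count w a
phi≡count w zero    = refl
phi≡count w (suc j) = begin
  length (filter (_≤? suc j) (nonzeroAlph w))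
    ≡⟨ length-filter≡count (deduplicate-! _) (deduplicate⁺ _≟_ (all-filter nonzero? w)) (suc j) ⟩
  count (nonzeroAlph w) (suc j)
    ≡⟨ Σ₁-cong (suc j) (λ m _ → occurs-cong to from) ⟩
  count w (suc j) ∎
  where
  nonzero? : ∀ i → Dec (i ≢ 0)
  nonzero? i = ¬? (i ≟ 0)
  to : ∀ {k} → k ∈ nonzeroAlph w → k ∈ w
  to = proj₁ ∘ ∈-filter⁻ nonzero? ∘ ∈-deduplicate⁻ _≟_ (filter nonzero? w)
  from : ∀ {m} → suc m ∈ w → suc m ∈ nonzeroAlph w
  from p = ∈-deduplicate⁺ _≟_ (∈-filter⁺ nonzero? p λ ())

map-fixed⇒fixed : ∀ {f : ℕ → ℕ} {xs x} → map f xs ≡ xs → x ∈ xs → f x ≡ x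
map-fixed⇒fixed {xs = _ ∷ _}  eq (here refl) = ∷-injectiveˡ eq
map-fixed⇒fixed {xs = _ ∷ xs} eq (there p)   = map-fixed⇒fixed (∷-injectiveʳ eq) p

packed⇒count : ∀ {w a} → Packed w → a ∈ w → count w a ≡ a
packed⇒count {w} {a} pw a∈w = trans (sym (phi≡count w a)) (map-fixed⇒fixed pw a∈w)

count⇒packed : ∀ {w} → (∀ {a} → a ∈ w → count w a ≡ a) → Packed w
count⇒packed {w} counts = map-id-local (All.tabulate λ {a} a∈w → trans (phi≡count w a) (counts a∈w))


∈⇒≤sup : ∀ {a} w → a ∈ w → a ≤ sup w
∈⇒≤sup (x ∷ w) (here refl) = m≤m⊔n x (sup w)
∈⇒≤sup (x ∷ w) (there a∈w) = ≤-trans (∈⇒≤sup w a∈w) (m≤n⊔m x (sup w))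

sup-attained : ∀ w → sup w ≡ 0 ⊎ sup w ∈ w
sup-attained [] = inj₁ refl
sup-attained (x ∷ w) with ⊔-sel x (sup w) | sup-attained w
... | inj₁ sup≡x | _             = inj₂ (here sup≡x)
... | inj₂ sup≡s | inj₁ s≡0      = inj₁ (trans sup≡s s≡0)
... | inj₂ sup≡s | inj₂ sup-w∈w  = inj₂ (there (subst (_∈ w) (sym sup≡s) sup-w∈w))

count-sup : ∀ {w} → Packed w → count w (sup w) ≡ sup w
count-sup {w} pw with sup-attained w
... | inj₁ sup≡0 = subst (λ s → count w s ≡ s) (sym sup≡0) refl
... | inj₂ sup∈w = packed⇒count pw sup∈w


unshift : ℕ → ℕ → ℕ
unshift t zero    = zero
unshift t (suc n) = suc n ∸ t

unshift-shift : ∀ t a → unshift t (shiftφ t a) ≡ a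
unshift-shift t zero    = refl
unshift-shift t (suc a) = m+n∸n≡m (suc a) t

U : ℕ → Word → Word
U t = map (unshift t)

U-T : ∀ t v → U t (T t v) ≡ v
U-T t v = trans (sym (map-∘ v)) (trans (map-cong (unshift-shift t) v) (map-id v))

T-injective : ∀ {t u v} → T t u ≡ T t v → u ≡ v
T-injective {t} {u} {v} eq = trans (sym (U-T t u)) (trans (cong (U t) eq) (U-T t v))

T-zero : ∀ v → T 0 v ≡ v
T-zero v = trans (map-cong shift-by-zero v) (map-id v)
  where
  shift-by-zero : ∀ a → shiftφ 0 a ≡ a
  shift-by-zero zero    = refl
  shift-by-zero (suc a) = +-identityʳ (suc a)

-- Shifting is monotone, hence commutes with ⊔.
shift-⊔ : ∀ t x y → shiftφ t (x ⊔ y) ≡ shiftφ t x ⊔ shiftφ t y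
shift-⊔ t zero    y       = refl
shift-⊔ t (suc x) zero    = sym (⊔-identityʳ _)
shift-⊔ t (suc x) (suc y) = +-distribʳ-⊔ t (suc x) (suc y)

-- Shifting by t and then by s is a single shift by the supremum of s and
-- the shifted t (this is what makes ⋆ associative).
shift-shift : ∀ s t x → shiftφ s (shiftφ t x) ≡ shiftφ (s ⊔ shiftφ s t) x
shift-shift s t       zero    = refl
shift-shift s zero    (suc n) = cong₂ _+_ (+-identityʳ (suc n)) (sym (⊔-identityʳ s))
shift-shift s (suc k) (suc n) = trans (+-assoc (suc n) (suc k) s)
  (cong (suc n +_) (sym (m≤n⇒m⊔n≡n (m≤n+m s (suc k)))))

sup-++ : ∀ a b → sup (a ++ b) ≡ sup a ⊔ sup b
sup-++ []      b = refl
sup-++ (x ∷ a) b = trans (cong (x ⊔_) (sup-++ a b)) (sym (⊔-assoc x (sup a) (sup b)))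

sup-T : ∀ t v → sup (T t v) ≡ shiftφ t (sup v)
sup-T t []      = refl
sup-T t (x ∷ v) = trans (cong (shiftφ t x ⊔_) (sup-T t v)) (sym (shift-⊔ t x (sup v)))

sup-⋆ : ∀ a b → sup (a ⋆ b) ≡ sup a ⊔ shiftφ (sup a) (sup b)
sup-⋆ a b = trans (sup-++ a (T (sup a) b)) (cong (sup a ⊔_) (sup-T (sup a) b))

⋆-assoc : ∀ a b c → a ⋆ (b ⋆ c) ≡ (a ⋆ b) ⋆ c
⋆-assoc a b c = begin
  a ++ T (sup a) (b ++ T (sup b) c)              ≡⟨ cong (a ++_) (map-++ (shiftφ (sup a)) b _) ⟩
  a ++ (T (sup a) b ++ T (sup a) (T (sup b) c))  ≡⟨ ++-assoc a (T (sup a) b) _ ⟨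
  (a ⋆ b) ++ T (sup a) (T (sup b) c)             ≡⟨ cong ((a ⋆ b) ++_) shift-twice ⟩
  (a ⋆ b) ++ T (sup (a ⋆ b)) c                   ∎
  where
  shift-twice : T (sup a) (T (sup b) c) ≡ T (sup (a ⋆ b)) c
  shift-twice = trans (sym (map-∘ c)) (trans (map-cong (shift-shift (sup a) (sup b)) c)
                                             (cong (λ s → T s c) (sym (sup-⋆ a b))))

⋆-product-++ : ∀ us vs → ⋆-product (us ++ vs) ≡ ⋆-product us ⋆ ⋆-product vs
⋆-product-++ []       vs = sym (T-zero (⋆-product vs))
⋆-product-++ (u ∷ us) vs = trans (cong (u ⋆_) (⋆-product-++ us vs)) (⋆-assoc u _ _)

⋆-length : ∀ u v → length (u ⋆ v) ≡ length u + length v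
⋆-length u v = trans (length-++ u) (cong (length u +_) (length-map _ v))

⋆-nonempty : ∀ {u v} → NonEmpty u → NonEmpty (u ⋆ v)
⋆-nonempty {u} nu u⋆v≡[] = nu (++-conicalˡ u _ u⋆v≡[])


⋆-low : ∀ {u v m} → m < sup u → suc m ∈ u ⋆ v → suc m ∈ u
⋆-low {u} {v} m<s p with ∈-++⁻ u p
... | inj₁ p∈u = p∈u
... | inj₂ p∈Tv with ∈-map⁻ (shiftφ (sup u)) p∈Tv
...   | suc b , _ , 1+m≡b+s = contradiction (subst (_≤ sup u) 1+m≡b+s m<s) (<⇒≱ (m<n+m (sup u) z<s))

⋆-high : ∀ {u v m} → suc m + sup u ∈ u ⋆ v → suc m ∈ v
⋆-high {u} {v} {m} p with ∈-++⁻ u p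
... | inj₁ p∈u = contradiction (∈⇒≤sup u p∈u) (<⇒≱ (m<n+m (sup u) z<s))
... | inj₂ p∈Tv with ∈-map⁻ (shiftφ (sup u)) p∈Tv
...   | suc b , b∈v , eq = subst (_∈ v) (sym (+-cancelʳ-≡ (sup u) (suc m) (suc b) eq)) b∈v

count-⋆ : ∀ u v n → count (u ⋆ v) (n + sup u) ≡ count u (sup u) + count v n
count-⋆ u v n = begin
  count (u ⋆ v) (n + sup u)
    ≡⟨ Σ₁-split (occurs (u ⋆ v)) (sup u) n ⟩
  count (u ⋆ v) (sup u) + Σ₁ (λ k → occurs (u ⋆ v) (k + sup u)) n
    ≡⟨ cong₂ _+_ (Σ₁-cong (sup u) low) (Σ₁-cong n high) ⟩
  count u (sup u) + count v n ∎
  where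
  low : ∀ m → m < sup u → occurs (u ⋆ v) (suc m) ≡ occurs u (suc m)
  low m m<s = occurs-cong (⋆-low m<s) ∈-++⁺ˡ
  high : ∀ m → m < n → occurs (u ⋆ v) (suc m + sup u) ≡ occurs v (suc m)
  high m _ = occurs-cong ⋆-high (∈-++⁺ʳ u ∘ ∈-map⁺ (shiftφ (sup u)))

-- If u and u ⋆ v are packed then so is v: the letter a of v appears as
-- a + sup u in u ⋆ v, where it is preceded by the sup u letters of u and
-- the letters of v below a.
right-factor-packed : ∀ {u v} → Packed u → Packed (u ⋆ v) → Packed v
right-factor-packed {u} {v} pu puv = count⇒packed counts
  where
  s : ℕ
  s = sup u
  counts : ∀ {a} → a ∈ v → count v a ≡ a
  counts {zero}  _   = refl
  counts {suc m} a∈v = +-cancelˡ-≡ s _ _ (begin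
    s + count v (suc m)          ≡⟨ cong (_+ count v (suc m)) (count-sup pu) ⟨
    count u s + count v (suc m)  ≡⟨ count-⋆ u v (suc m) ⟨
    count (u ⋆ v) (suc m + s)    ≡⟨ packed⇒count puv (∈-++⁺ʳ u (∈-map⁺ (shiftφ s) a∈v)) ⟩
    suc m + s                    ≡⟨ +-comm (suc m) s ⟩
    s + suc m                    ∎)


++-overlap : ∀ {a} {A : Set a} (xs ys zs ws : List A) → xs ++ ys ≡ zs ++ ws →
             length xs ≤ length zs → Σ (List A) λ ds → zs ≡ xs ++ ds × ys ≡ ds ++ ws
++-overlap []       ys zs       ws eq _         = zs , refl , eq
++-overlap (x ∷ xs) ys (z ∷ zs) ws eq (s≤s len) with ++-overlap xs ys zs ws (∷-injectiveʳ eq) len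
... | ds , zs≡ , ys≡ = ds , cong₂ _∷_ (sym (∷-injectiveˡ eq)) zs≡ , ys≡

take-++-length : ∀ {a} {A : Set a} (xs ys : List A) → take (length xs) (xs ++ ys) ≡ xs
take-++-length []       ys = refl
take-++-length (x ∷ xs) ys = cong (x ∷_) (take-++-length xs ys)

drop-++-length : ∀ {a} {A : Set a} (xs ys : List A) → drop (length xs) (xs ++ ys) ≡ ys
drop-++-length []       ys = refl
drop-++-length (x ∷ xs) ys = drop-++-length xs ys

shifted-prefix : ∀ {t} r xs ds → T t r ≡ xs ++ ds → T t (take (length xs) r) ≡ xs
shifted-prefix r xs ds eq =
  trans (sym (take-map (length xs) r)) (trans (cong (take (length xs)) eq) (take-++-length xs ds))

irreducible-⋆-empty : ∀ {u w y} → Packed u → NonEmpty u → Irreducible w → w ≡ u ⋆ y → y ≡ []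
irreducible-⋆-empty {y = []}    _  _  _              _    = refl
irreducible-⋆-empty {u} {y = b ∷ y} pu nu (pw , irreducible) w≡u⋆y =
  ⊥-elim (irreducible u (b ∷ y) pu (right-factor-packed pu (subst Packed w≡u⋆y pw)) nu (λ ()) w≡u⋆y)

irreducible-prefix : ∀ {u w d r} → Packed u → NonEmpty u → Irreducible w → length u ≤ length w →
                     w ++ d ≡ u ++ T (sup u) r → w ≡ u
irreducible-prefix {u} {w} {d} {r} pu nu irr-w |u|≤|w| eq =
  let xs , w≡u++xs , Tr≡xs++d = ++-overlap u (T (sup u) r) w d (sym eq) |u|≤|w|
      w≡u⋆y = trans w≡u++xs (cong (u ++_) (sym (shifted-prefix r xs d Tr≡xs++d)))
  in begin
    w                        ≡⟨ w≡u⋆y ⟩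
    u ⋆ take (length xs) r   ≡⟨ cong (u ⋆_) (irreducible-⋆-empty pu nu irr-w w≡u⋆y) ⟩
    u ++ []                  ≡⟨ ++-identityʳ u ⟩
    u                        ∎

leading-factor-unique : ∀ {v w r r′} → NonEmpty v → Irreducible v → NonEmpty w → Irreducible w →
                        v ⋆ r ≡ w ⋆ r′ → v ≡ w
leading-factor-unique {v} {w} nv irr-v nw irr-w eq with ≤-total (length v) (length w)
... | inj₁ |v|≤|w| = sym (irreducible-prefix (proj₁ irr-v) nv irr-w |v|≤|w| (sym eq))
... | inj₂ |w|≤|v| = irreducible-prefix (proj₁ irr-w) nw irr-v |w|≤|v| eq

factorisation-unique : ∀ {vs ws} → AllIrr vs → AllIrr ws → ⋆-product vs ≡ ⋆-product ws → vs ≡ ws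
factorisation-unique []                 []             _  = refl
factorisation-unique []                 ((nw , _) ∷ _) eq = contradiction (sym eq) (⋆-nonempty nw)
factorisation-unique ((nv , _) ∷ _)     []             eq = contradiction eq (⋆-nonempty nv)
factorisation-unique {v ∷ vs} {w ∷ ws} ((nv , irr-v) ∷ irr-vs) ((nw , irr-w) ∷ irr-ws) eq
  with refl ← leading-factor-unique nv irr-v nw irr-w eq
  = cong (v ∷_) (factorisation-unique irr-vs irr-ws (T-injective (++-cancelˡ v _ _ eq)))


Splitting : Word → Word → Word → Set
Splitting w u v = Packed u × Packed v × NonEmpty u × NonEmpty v × w ≡ u ⋆ v

Reducible : Word → Set
Reducible w = Σ Word λ u → Σ Word λ v → Splitting w u v

splitting? : ∀ w u v → Dec (Splitting w u v)
splitting? w u v = packed? u ×-dec packed? v ×-dec nonempty? u ×-dec nonempty? v ×-dec ≡-dec _≟_ w (u ⋆ v)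
  where
  packed? : ∀ x → Dec (Packed x)
  packed? x = ≡-dec _≟_ (pack x) x
  nonempty? : ∀ x → Dec (NonEmpty x)
  nonempty? x = ¬? (≡-dec _≟_ x [])

-- The cut of w after k letters: the only candidate splitting with |u| = k.
Cut : Word → ℕ → Set
Cut w k = Splitting w (take k w) (U (sup (take k w)) (drop k w))

splitting⇒cut : ∀ {w u v} → Splitting w u v → Cut w (length u)
splitting⇒cut {u = u} {v} (pu , pv , nu , nv , refl)
  rewrite take-++-length u (T (sup u) v) | drop-++-length u (T (sup u) v) | U-T (sup u) v =
  pu , pv , nu , nv , refl

cut? : ∀ w k → Dec (Cut w k)
cut? w k = splitting? w (take k w) (U (sup (take k w)) (drop k w))

reducible? : ∀ w → Dec (Reducible w)
reducible? w with anyUpTo? (cut? w) (suc (length w))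
... | yes (_ , _ , cut) = yes (_ , _ , cut)
... | no  no-cut        = no λ (u , v , splitting@(_ , _ , _ , _ , w≡u⋆v)) →
  let |u|≤|w| = subst (length u ≤_) (cong length (sym w≡u⋆v)) (length-++-≤ˡ u)
  in no-cut (length u , s≤s |u|≤|w| , splitting⇒cut splitting)

splitting-shorter : ∀ {w u v} → NonEmpty u → NonEmpty v → w ≡ u ⋆ v →
                    length u < length w × length v < length w
splitting-shorter {u = u} {v} nu nv refl rewrite ⋆-length u v =
  m<m+n (length u) (nonempty-length nv) , m<n+m (length v) (nonempty-length nu)
  where
  nonempty-length : ∀ {x : Word} → NonEmpty x → 0 < length x
  nonempty-length {[]}    nx = contradiction refl nx
  nonempty-length {_ ∷ _} _  = z<s

¬reducible⇒irreducible : ∀ {w} → Packed w → ¬ Reducible w → Irreducible w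
¬reducible⇒irreducible pw ¬reducible =
  pw , λ u v pu pv nu nv eq → ¬reducible (u , v , pu , pv , nu , nv , eq)

AllIrr-++ : ∀ {us vs} → AllIrr us → AllIrr vs → AllIrr (us ++ vs)
AllIrr-++ []               irr-vs = irr-vs
AllIrr-++ (irr-u ∷ irr-us) irr-vs = irr-u ∷ AllIrr-++ irr-us irr-vs

factorise : ∀ w → Acc _<_ (length w) → Packed w → Σ (List Word) (IrrFactorisation w)
factorise [] _ _ = [] , [] , refl
factorise w@(_ ∷ _) (acc shorter) pw with reducible? w
... | no ¬reducible = [ w ] , ((λ ()) , ¬reducible⇒irreducible pw ¬reducible) ∷ [] , ++-identityʳ w
... | yes (u , v , pu , pv , nu , nv , w≡u⋆v) =
  let |u|<|w| , |v|<|w| = splitting-shorter nu nv w≡u⋆v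
      us , irr-us , us≡u = factorise u (shorter |u|<|w|) pu
      vs , irr-vs , vs≡v = factorise v (shorter |v|<|w|) pv
  in us ++ vs , AllIrr-++ irr-us irr-vs , (begin
       ⋆-product (us ++ vs)          ≡⟨ ⋆-product-++ us vs ⟩
       ⋆-product us ⋆ ⋆-product vs   ≡⟨ cong₂ _⋆_ us≡u vs≡v ⟩
       u ⋆ v                         ≡⟨ w≡u⋆v ⟨
       w                             ∎)


mainTheorem2 : (w : Word) → Packed w →
    Σ (List Word) (λ vs → IrrFactorisation w vs) ×
    ((vs ws : List Word) → IrrFactorisation w vs → IrrFactorisation w ws → vs ≡ ws)
mainTheorem2 w pw =
  factorise w (<-wellFounded (length w)) pw ,
  λ vs ws (irr-vs , vs≡w) (irr-ws , ws≡w) → factorisation-unique irr-vs irr-ws (trans vs≡w (sym ws≡w))
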